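{- Let $G=(V,E)$ be an undirected graph with terminal set $T\subseteq V$. Let $G'=(V',E')$ be a graph obtained from $G$ by a finite sequence of element-connectivity preserving reduction operations; each edge of $G'$ corresponds to a unique edge of $G$. Let $p'q'\in E'$ be an edge between two non-terminals of $G'$ such that deleting $p'q'$ from $G'$ is element-connectivity preserving, i.e. $\kappa'_{(G'-p'q',T)}(u,v)=\kappa'_{(G',T)}(u,v)$ for all distinct $u,v\in T$. Let $pq\in E$ be the edge of $G$ corresponding to $p'q'$. Then deleting $pq$ from $G$ is element-connectivity preserving, i.e. $\kappa'_{(G-pq,T)}(u,v)=\kappa'_{(G,T)}(u,v)$ for all distinct $u,v\in T$.
   Context: For an undirected graph $G=(V,E)$ with a set $T\subseteq V$ of terminals, vertices in $V-T$ are non-terminals, and the non-terminals together with the edges are called elements. For distinct $u,v\in T$, the element-connectivity is $\kappa'_{(G,T)}(u,v):=\min\{|F| : F\subseteq (V-T)\cup E,\ u \text{ and } v \text{ are disconnected in } G-F\}$. For an edge $e$, $G-e$ denotes deletion of $e$ and $G_{/e}$ contraction of $e$ (a contracted vertex formed from two non-terminals is a non-terminal). An element-connectivity preserving reduction operation on a graph with terminal set $T$ is either deleting or contracting an edge $pq$ with both $p,q$ non-terminals, such that the resulting graph $G^\circ$ satisfies $\kappa'_{(G^\circ,T)}(u,v)=\kappa'_{(G,T)}(u,v)$ for all distinct $u,v\in T$. Terminals are never deleted or contracted, so the terminal set is the same throughout. -}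

module Defs where

open import Data.Nat using (ℕ; suc; _+_; _≤_)
open import Data.Fin using (Fin; punchIn; punchOut; _≟_)
open import Data.Fin.Subset using (Subset; _∉_; ∣_∣)
open import Data.Sum using (_⊎_; inj₁; inj₂)
import Data.Sum as Sum
open import Data.Product using (_×_; _,_; Σ; ∃₂)
import Data.Product as Prod
open import Data.Unit using (⊤)
open import Function using (_∘_; id)
open import Function.Bundles using (_⇔_)
open import Relation.Nullary using (¬_; yes; no)
open import Relation.Binary.PropositionalEquality using (_≡_; _≢_; sym)

-- Vertices of a graph with t terminals and k non-terminals:
-- inj₁ i is the i-th terminal, inj₂ a is the a-th non-terminal.
Vtx : ℕ → ℕ → Set
Vtx t k = Fin t ⊎ Fin k

-- A finite undirected multigraph with t terminals, k non-terminals and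
-- m edges; edge e has (unordered) endpoints  ends e.
record Graph (t k m : ℕ) : Set where
  field
    ends : Fin m → Vtx t k × Vtx t k
open Graph public

Joins : ∀ {t k m} → Graph t k m → Fin m → Vtx t k → Vtx t k → Set
Joins G e x y = ends G e ≡ (x , y) ⊎ ends G e ≡ (y , x)

delete : ∀ {t k m} → Graph t k (suc m) → Fin (suc m) → Graph t k m
ends (delete G e) j = ends G (punchIn e j)

-- merging non-terminal q into non-terminal p (p ≢ q)
mergeNT : ∀ {k} (p q : Fin (suc k)) → p ≢ q → Fin (suc k) → Fin k
mergeNT p q p≢q x with q ≟ x
... | yes _   = punchOut {i = q} {j = p} (λ q≡p → p≢q (sym q≡p))
... | no q≢x = punchOut q≢x

mergeV : ∀ {t k} (p q : Fin (suc k)) → p ≢ q → Vtx t (suc k) → Vtx t k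
mergeV p q p≢q = Sum.map₂ (mergeNT p q p≢q)

-- G / e  where e joins the distinct non-terminals p and q; the
-- contracted vertex is a non-terminal. Edge j of G / e corresponds
-- to edge  punchIn e j  of G (parallel edges / loops are kept).
contract : ∀ {t k m} → Graph t (suc k) (suc m) → Fin (suc m)
         → (p q : Fin (suc k)) → p ≢ q → Graph t k m
ends (contract G e p q p≢q) j =
  Prod.map (mergeV p q p≢q) (mergeV p q p≢q) (ends G (punchIn e j))

Alive : ∀ {t k} → Subset k → Vtx t k → Set
Alive Fv (inj₁ _) = ⊤
Alive Fv (inj₂ a) = a ∉ Fv

-- x reaches z in G - F, where F = Fv ∪ Fe  (Fv non-terminals, Fe edges)
data Reach {t k m} (G : Graph t k m) (Fv : Subset k) (Fe : Subset m)
     : Vtx t k → Vtx t k → Set where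
  stop : ∀ {x} → Reach G Fv Fe x x
  step : ∀ {x y z} (e : Fin m) → e ∉ Fe → Joins G e x y → Alive Fv y
       → Reach G Fv Fe y z → Reach G Fv Fe x z

Separates : ∀ {t k m} → Graph t k m → Fin t → Fin t → Subset k → Subset m → Set
Separates G u v Fv Fe = ¬ Reach G Fv Fe (inj₁ u) (inj₁ v)

ElemConn : ∀ {t k m} → Graph t k m → Fin t → Fin t → ℕ → Set
ElemConn G u v c =
  (∃₂ λ Fv Fe → Separates G u v Fv Fe × ∣ Fv ∣ + ∣ Fe ∣ ≡ c)
  × (∀ Fv Fe → Separates G u v Fv Fe → c ≤ ∣ Fv ∣ + ∣ Fe ∣)

PreservesEC : ∀ {t k m k' m'} → Graph t k m → Graph t k' m' → Set
PreservesEC {t} G G° = ∀ (u v : Fin t) → u ≢ v → ∀ c → ElemConn G° u v c ⇔ ElemConn G u v c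

-- Reduces G G' ρ : G' is obtained from G by a finite sequence of
-- element-connectivity preserving reduction operations, and edge j of
-- G' corresponds to edge  ρ j  of G.
data Reduces {t : ℕ} : ∀ {k m k' m'} → Graph t k m → Graph t k' m'
     → (Fin m' → Fin m) → Set where
  done : ∀ {k m} {G : Graph t k m} → Reduces G G id
  del  : ∀ {k m k' m'} {G : Graph t k (suc m)} {G' : Graph t k' m'} {ρ}
         (e : Fin (suc m)) (p q : Fin k) → Joins G e (inj₂ p) (inj₂ q)
       → PreservesEC G (delete G e)
       → Reduces (delete G e) G' ρ → Reduces G G' (punchIn e ∘ ρ)
  con  : ∀ {k m k' m'} {G : Graph t (suc k) (suc m)} {G' : Graph t k' m'} {ρ}
         (e : Fin (suc m)) (p q : Fin (suc k)) (p≢q : p ≢ q)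
       → Joins G e (inj₂ p) (inj₂ q)
       → PreservesEC G (contract G e p q p≢q)
       → Reduces (contract G e p q p≢q) G' ρ → Reduces G G' (punchIn e ∘ ρ)

-- Neither deleting an edge nor contracting an edge between non-terminals
-- can increase an element-connectivity: a separator F of G restricts to a
-- separator of G − e, and it becomes a separator of G / pq once the merged
-- vertex is added whenever p, q or pq belonged to F, which never makes F
-- larger because p, q and pq themselves disappear. The reductions leading
-- from G to G' also lead from G − pq to G' − p'q', so
--   κ'(G) = κ'(G') = κ'(G' − p'q') ≤ κ'(G − pq) ≤ κ'(G).
-- The separators being finite and reachability decidable, κ'(G) exists.
module Submission where

open import Defs
open import Data.Bool using (Bool; true; false; _∨_)
open import Data.Empty using (⊥-elim)
open import Data.Fin using (Fin; zero; suc; punchIn; punchOut; _≟_)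
open import Data.Fin.Properties using (punchIn-punchOut; punchInᵢ≢i)
open import Data.Fin.Subset using (Subset; _∈_; _∉_; ∣_∣; ⊥; ⊤; inside; outside)
open import Data.Fin.Subset.Properties using (_∈?_; anySubset?; ∈⊤; drop-there)
open import Data.Nat using (ℕ; zero; suc; _+_; _≤_; _<_; _<?_; z≤n; s≤s)
open import Data.Nat.Induction using (<-wellFounded)
open import Data.Nat.Properties
  using ( +-assoc; ≤-refl; ≤-trans; ≤-antisym; m≤n+m; +-mono-≤; +-monoˡ-≤; +-cancelˡ-≤; ≮⇒≥
        ; +-commutativeSemigroup; module ≤-Reasoning)
open import Algebra.Properties.CommutativeSemigroup +-commutativeSemigroup using (x∙yz≈y∙xz)
open import Data.Nat.Solver using (module +-*-Solver)
open import Data.Product using (_×_; _,_; Σ; ∃₂; proj₁; proj₂)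
import Data.Product as Prod
open import Data.Sum using (_⊎_; inj₁; inj₂)
import Data.Sum as Sum
open import Data.Sum.Properties using (≡-dec; inj₁-injective)
open import Data.Unit using (tt)
open import Data.Vec using (_∷_; []; lookup; removeAt; _[_]≔_; here; there)
open import Data.Vec.Properties using ([]=⇒lookup; lookup⇒[]=; lookup∘update; lookup∘update′)
open import Function using (_∘_)
open import Function.Bundles using (_⇔_; mk⇔; Equivalence)
open import Function.Construct.Composition using (_⇔-∘_)
open import Function.Construct.Identity using (⇔-id)
open import Induction.WellFounded using (Acc; acc)
open import Relation.Binary.PropositionalEquality
open import Relation.Nullary using (Dec; yes; no)
open import Relation.Nullary.Decidable using (map′; ¬?; _×-dec_; _⊎-dec_)

indicator : Bool → ℕ
indicator true  = 1
indicator false = 0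

indicator-∨ : ∀ α β γ → indicator (α ∨ β ∨ γ) ≤ indicator α + indicator β + indicator γ
indicator-∨ true  β     γ     = s≤s z≤n
indicator-∨ false true  γ     = s≤s z≤n
indicator-∨ false false true  = s≤s z≤n
indicator-∨ false false false = z≤n

∣∷∣ : ∀ {n} x (p : Subset n) → ∣ x ∷ p ∣ ≡ indicator x + ∣ p ∣
∣∷∣ true  p = refl
∣∷∣ false p = refl

lookup-removeAt : ∀ {n} (p : Subset (suc n)) i j → lookup (removeAt p i) j ≡ lookup p (punchIn i j)
lookup-removeAt (x ∷ p)     zero    j       = refl
lookup-removeAt (x ∷ y ∷ p) (suc i) zero    = refl
lookup-removeAt (x ∷ y ∷ p) (suc i) (suc j) = lookup-removeAt (y ∷ p) i j

∈-removeAt : ∀ {n} (p : Subset (suc n)) i j → punchIn i j ∈ p → j ∈ removeAt p i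
∈-removeAt (x ∷ p)     zero    j       i∈p = drop-there i∈p
∈-removeAt (x ∷ y ∷ p) (suc i) zero    here = here
∈-removeAt (x ∷ y ∷ p) (suc i) (suc j) i∈p = there (∈-removeAt (y ∷ p) i j (drop-there i∈p))

∣removeAt∣ : ∀ {n} (p : Subset (suc n)) i → indicator (lookup p i) + ∣ removeAt p i ∣ ≡ ∣ p ∣
∣removeAt∣ (x ∷ p)     zero    = sym (∣∷∣ x p)
∣removeAt∣ (x ∷ y ∷ p) (suc i) = begin
  pᵢ + ∣ x ∷ removeAt (y ∷ p) i ∣    ≡⟨ cong (pᵢ +_) (∣∷∣ x (removeAt (y ∷ p) i)) ⟩
  pᵢ + (indicator x + r)             ≡⟨ x∙yz≈y∙xz pᵢ (indicator x) r ⟩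
  indicator x + (pᵢ + r)             ≡⟨ cong (indicator x +_) (∣removeAt∣ (y ∷ p) i) ⟩
  indicator x + ∣ y ∷ p ∣            ≡⟨ sym (∣∷∣ x (y ∷ p)) ⟩
  ∣ x ∷ y ∷ p ∣                      ∎
  where
  open ≡-Reasoning
  pᵢ = indicator (lookup (y ∷ p) i)
  r  = ∣ removeAt (y ∷ p) i ∣

∣removeAt∣≤ : ∀ {n} (p : Subset (suc n)) i → ∣ removeAt p i ∣ ≤ ∣ p ∣
∣removeAt∣≤ p i = subst (∣ removeAt p i ∣ ≤_) (∣removeAt∣ p i) (m≤n+m ∣ removeAt p i ∣ _)

∣update∣ : ∀ {n} (p : Subset n) i x → indicator (lookup p i) + ∣ p [ i ]≔ x ∣ ≡ indicator x + ∣ p ∣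
∣update∣ (y ∷ p) zero    x = begin
  indicator y + ∣ x ∷ p ∣              ≡⟨ cong (indicator y +_) (∣∷∣ x p) ⟩
  indicator y + (indicator x + ∣ p ∣)  ≡⟨ x∙yz≈y∙xz (indicator y) (indicator x) ∣ p ∣ ⟩
  indicator x + (indicator y + ∣ p ∣)  ≡⟨ cong (indicator x +_) (sym (∣∷∣ y p)) ⟩
  indicator x + ∣ y ∷ p ∣              ∎
  where open ≡-Reasoning
∣update∣ (y ∷ p) (suc i) x = begin
  pᵢ + ∣ y ∷ (p [ i ]≔ x) ∣            ≡⟨ cong (pᵢ +_) (∣∷∣ y (p [ i ]≔ x)) ⟩
  pᵢ + (indicator y + u)               ≡⟨ x∙yz≈y∙xz pᵢ (indicator y) u ⟩
  indicator y + (pᵢ + u)               ≡⟨ cong (indicator y +_) (∣update∣ p i x) ⟩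
  indicator y + (indicator x + ∣ p ∣)  ≡⟨ x∙yz≈y∙xz (indicator y) (indicator x) ∣ p ∣ ⟩
  indicator x + (indicator y + ∣ p ∣)  ≡⟨ cong (indicator x +_) (sym (∣∷∣ y p)) ⟩
  indicator x + ∣ y ∷ p ∣              ∎
  where
  open ≡-Reasoning
  pᵢ = indicator (lookup p i)
  u  = ∣ p [ i ]≔ x ∣

∉⇒lookup≡false : ∀ {n} {p : Subset n} {i} → i ∉ p → lookup p i ≡ false
∉⇒lookup≡false {p = p} {i} i∉p with lookup p i in eq
... | true  = ⊥-elim (i∉p (lookup⇒[]= i p eq))
... | false = refl

lookup≡false⇒∉ : ∀ {n} {p : Subset n} {i} → lookup p i ≡ false → i ∉ p
lookup≡false⇒∉ eq i∈p with trans (sym ([]=⇒lookup i∈p)) eq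
... | ()

Reach-trans : ∀ {t k m} {G : Graph t k m} {Fv Fe x y z}
            → Reach G Fv Fe x y → Reach G Fv Fe y z → Reach G Fv Fe x z
Reach-trans stop               q = q
Reach-trans (step e e∉ J al p) q = step e e∉ J al (Reach-trans p q)

Reach-resp-ends : ∀ {t k m} {G H : Graph t k m} → (∀ j → ends G j ≡ ends H j)
                → ∀ {Fv Fe x z} → Reach G Fv Fe x z → Reach H Fv Fe x z
Reach-resp-ends G≗H stop                      = stop
Reach-resp-ends G≗H (step e e∉ (inj₁ J) al p) = step e e∉ (inj₁ (trans (sym (G≗H e)) J)) al (Reach-resp-ends G≗H p)
Reach-resp-ends G≗H (step e e∉ (inj₂ J) al p) = step e e∉ (inj₂ (trans (sym (G≗H e)) J)) al (Reach-resp-ends G≗H p)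

Reach-delete : ∀ {t k m} (G : Graph t k (suc m)) d {Fv Fe x z}
             → Reach (delete G d) Fv (removeAt Fe d) x z → Reach G Fv Fe x z
Reach-delete G d stop = stop
Reach-delete G d {Fe = Fe} (step e e∉ J al p) =
  step (punchIn d e) (e∉ ∘ ∈-removeAt Fe d e) J al (Reach-delete G d p)

Reach-⊤ : ∀ {t k m} {G : Graph t k m} {Fv x z} → Reach G Fv ⊤ x z → x ≡ z
Reach-⊤ stop               = refl
Reach-⊤ (step e e∉ _ _ _) = ⊥-elim (e∉ ∈⊤)

Alive? : ∀ {t k} (Fv : Subset k) (x : Vtx t k) → Dec (Alive Fv x)
Alive? Fv (inj₁ _) = yes tt
Alive? Fv (inj₂ a) = ¬? (a ∈? Fv)

-- A walk in G that uses edge zero = ab can be shortcut to use it only once.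
module ThroughEdgeZero {t k m} (G : Graph t k (suc m)) (Fv : Subset k) (Fe : Subset m) where

  private
    _⇝_ : Vtx t k → Vtx t k → Set
    _⇝_ = Reach (delete G zero) Fv Fe
    a b : Vtx t k
    a = proj₁ (ends G zero)
    b = proj₂ (ends G zero)

  Through : Vtx t k → Vtx t k → Set
  Through x z = x ⇝ z ⊎ (x ⇝ a × Alive Fv b × b ⇝ z) ⊎ (x ⇝ b × Alive Fv a × a ⇝ z)

  Through? : (∀ x z → Dec (x ⇝ z)) → ∀ x z → Dec (Through x z)
  Through? _⇝?_ x z = x ⇝? z ⊎-dec (x ⇝? a ×-dec Alive? Fv b ×-dec b ⇝? z)
                              ⊎-dec (x ⇝? b ×-dec Alive? Fv a ×-dec a ⇝? z)

  prepend : ∀ {x y z} → x ⇝ y → Through y z → Through x z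
  prepend p (inj₁ q)                   = inj₁ (Reach-trans p q)
  prepend p (inj₂ (inj₁ (q , al , r))) = inj₂ (inj₁ (Reach-trans p q , al , r))
  prepend p (inj₂ (inj₂ (q , al , r))) = inj₂ (inj₂ (Reach-trans p q , al , r))

  cross-ab : ∀ {z} → Alive Fv b → Through b z → Through a z
  cross-ab al (inj₁ q)                  = inj₂ (inj₁ (stop , al , q))
  cross-ab _  (inj₂ (inj₁ (_ , al , r))) = inj₂ (inj₁ (stop , al , r))
  cross-ab _  (inj₂ (inj₂ (_ , _ , r)))  = inj₁ r

  cross-ba : ∀ {z} → Alive Fv a → Through a z → Through b z
  cross-ba al (inj₁ q)                  = inj₂ (inj₂ (stop , al , q))
  cross-ba _  (inj₂ (inj₁ (_ , _ , r)))  = inj₁ r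
  cross-ba _  (inj₂ (inj₂ (_ , al , r))) = inj₂ (inj₂ (stop , al , r))

  to : ∀ {x z} → Reach G Fv (outside ∷ Fe) x z → Through x z
  to stop                              = inj₁ stop
  to (step zero    _  (inj₁ refl) al p) = cross-ab al (to p)
  to (step zero    _  (inj₂ refl) al p) = cross-ba al (to p)
  to (step (suc e) e∉ J           al p) = prepend (step e (e∉ ∘ there) J al stop) (to p)

  from : ∀ {x z} → Through x z → Reach G Fv (outside ∷ Fe) x z
  from (inj₁ p)                   = Reach-delete G zero p
  from (inj₂ (inj₁ (p , al , q))) =
    Reach-trans (Reach-delete G zero p) (step zero (λ ()) (inj₁ refl) al (Reach-delete G zero q))
  from (inj₂ (inj₂ (p , al , q))) =
    Reach-trans (Reach-delete G zero p) (step zero (λ ()) (inj₂ refl) al (Reach-delete G zero q))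

Reach-avoid-zero : ∀ {t k m} {G : Graph t k (suc m)} {Fv Fe x z}
                 → Reach G Fv (inside ∷ Fe) x z → Reach (delete G zero) Fv Fe x z
Reach-avoid-zero stop                      = stop
Reach-avoid-zero (step zero    e∉ _ _  _)  = ⊥-elim (e∉ here)
Reach-avoid-zero (step (suc e) e∉ J al p)  = step e (e∉ ∘ there) J al (Reach-avoid-zero p)

Reach? : ∀ {t k m} (G : Graph t k m) Fv Fe x z → Dec (Reach G Fv Fe x z)
Reach? {m = zero}  G Fv []            x z = map′ (λ { refl → stop }) Reach-⊤ (≡-dec _≟_ _≟_ x z)
Reach? {m = suc m} G Fv (inside ∷ Fe) x z =
  map′ (Reach-delete G zero) Reach-avoid-zero (Reach? (delete G zero) Fv Fe x z)
Reach? {m = suc m} G Fv (outside ∷ Fe) x z =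
  map′ from to (Through? (Reach? (delete G zero) Fv Fe) x z)
  where open ThroughEdgeZero G Fv Fe

-- κ'(G°) ≤ κ'(G), witnessed separator by separator.
SeparatorTransfer : ∀ {t k m k° m°} → Graph t k m → Graph t k° m° → Set
SeparatorTransfer {t} G G° = ∀ (u v : Fin t) Fv Fe → Separates G u v Fv Fe
  → ∃₂ λ Fv° Fe° → Separates G° u v Fv° Fe° × ∣ Fv° ∣ + ∣ Fe° ∣ ≤ ∣ Fv ∣ + ∣ Fe ∣

SeparatorTransfer-refl : ∀ {t k m} {G : Graph t k m} → SeparatorTransfer G G
SeparatorTransfer-refl u v Fv Fe sep = Fv , Fe , sep , ≤-refl

SeparatorTransfer-trans : ∀ {t k₁ m₁ k₂ m₂ k₃ m₃}
  {G₁ : Graph t k₁ m₁} {G₂ : Graph t k₂ m₂} {G₃ : Graph t k₃ m₃}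
  → SeparatorTransfer G₁ G₂ → SeparatorTransfer G₂ G₃ → SeparatorTransfer G₁ G₃
SeparatorTransfer-trans T₁₂ T₂₃ u v Fv Fe sep with T₁₂ u v Fv Fe sep
... | Fv₂ , Fe₂ , sep₂ , ≤₂ with T₂₃ u v Fv₂ Fe₂ sep₂
... | Fv₃ , Fe₃ , sep₃ , ≤₃ = Fv₃ , Fe₃ , sep₃ , ≤-trans ≤₃ ≤₂

SeparatorTransfer-resp-ends : ∀ {t k m} {G H : Graph t k m} → (∀ j → ends G j ≡ ends H j)
                            → SeparatorTransfer G H
SeparatorTransfer-resp-ends G≗H u v Fv Fe sep =
  Fv , Fe , sep ∘ Reach-resp-ends (sym ∘ G≗H) , ≤-refl

delete-separatorTransfer : ∀ {t k m} (G : Graph t k (suc m)) d → SeparatorTransfer G (delete G d)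
delete-separatorTransfer G d u v Fv Fe sep =
  Fv , removeAt Fe d , sep ∘ Reach-delete G d , +-mono-≤ (≤-refl {∣ Fv ∣}) (∣removeAt∣≤ Fe d)

ElemConn-unique : ∀ {t k m} {G : Graph t k m} {u v c d} → ElemConn G u v c → ElemConn G u v d → c ≡ d
ElemConn-unique ((Fv , Fe , sep , refl) , c≤) ((Fv′ , Fe′ , sep′ , refl) , d≤) =
  ≤-antisym (c≤ Fv′ Fe′ sep′) (d≤ Fv Fe sep)

ElemConn-⇔ : ∀ {t k m k′ m′} {G : Graph t k m} {H : Graph t k′ m′} {u v d}
           → ElemConn G u v d → ElemConn H u v d → ∀ c → ElemConn G u v c ⇔ ElemConn H u v c
ElemConn-⇔ {H = H} {u} {v} κG κH c = mk⇔
  (λ κG′ → subst (ElemConn H u v) (ElemConn-unique κG κG′) κH)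
  (λ κH′ → subst (ElemConn _ u v) (ElemConn-unique κH κH′) κG)

ElemConn-squeeze : ∀ {t k₁ m₁ k₂ m₂ k₃ m₃}
  {G₁ : Graph t k₁ m₁} {G₂ : Graph t k₂ m₂} {G₃ : Graph t k₃ m₃} {u v d}
  → SeparatorTransfer G₁ G₂ → SeparatorTransfer G₂ G₃
  → ElemConn G₁ u v d → ElemConn G₃ u v d → ElemConn G₂ u v d
ElemConn-squeeze {u = u} {v} T₁₂ T₂₃ ((Fv , Fe , sep , refl) , _) (_ , d≤₃) with T₁₂ u v Fv Fe sep
... | Fv₂ , Fe₂ , sep₂ , ≤d = (Fv₂ , Fe₂ , sep₂ , ≤-antisym ≤d (d≤₂ Fv₂ Fe₂ sep₂)) , d≤₂
  where
  d≤₂ : ∀ Fv′ Fe′ → Separates _ u v Fv′ Fe′ → ∣ Fv ∣ + ∣ Fe ∣ ≤ ∣ Fv′ ∣ + ∣ Fe′ ∣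
  d≤₂ Fv′ Fe′ sep′ with T₂₃ u v Fv′ Fe′ sep′
  ... | Fv₃ , Fe₃ , sep₃ , ≤′ = ≤-trans (d≤₃ Fv₃ Fe₃ sep₃) ≤′

module _ {t k m} (G : Graph t k m) (u v : Fin t) where

  private
    Size : Subset k → Subset m → ℕ
    Size Fv Fe = ∣ Fv ∣ + ∣ Fe ∣

  SmallerSeparator? : ∀ n → Dec (∃₂ λ Fv Fe → Separates G u v Fv Fe × Size Fv Fe < n)
  SmallerSeparator? n = anySubset? λ Fv → anySubset? λ Fe →
    ¬? (Reach? G Fv Fe (inj₁ u) (inj₁ v)) ×-dec (Size Fv Fe <? n)

  minimiseSeparator : ∀ {n} → Acc _<_ n → (∃₂ λ Fv Fe → Separates G u v Fv Fe × Size Fv Fe ≡ n)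
                    → Σ ℕ (ElemConn G u v)
  minimiseSeparator {n} (acc smaller) sep with SmallerSeparator? n
  ... | yes (Fv , Fe , sep′ , <n) = minimiseSeparator (smaller <n) (Fv , Fe , sep′ , refl)
  ... | no  none                  = n , sep , λ Fv Fe sep′ → ≮⇒≥ (λ <n → none (Fv , Fe , sep′ , <n))

  ElemConn-exists : u ≢ v → Σ ℕ (ElemConn G u v)
  ElemConn-exists u≢v = minimiseSeparator (<-wellFounded _) (⊥ , ⊤ , u≢v ∘ inj₁-injective ∘ Reach-⊤ , refl)

-- Contracting an edge between non-terminals

∨³≡false : ∀ α β γ → α ∨ β ∨ γ ≡ false → α ≡ false × β ≡ false × γ ≡ false
∨³≡false false false false refl = refl , refl , refl

module Contraction {t k m} (G : Graph t (suc k) (suc m)) (f : Fin (suc m))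
                   (a b : Fin (suc k)) (a≢b : a ≢ b) (J : Joins G f (inj₂ a) (inj₂ b)) where

  merged : Fin k
  merged = punchOut {i = b} {j = a} (λ b≡a → a≢b (sym b≡a))

  merge : Vtx t (suc k) → Vtx t k
  merge = mergeV a b a≢b

  unmerge : Vtx t k → Vtx t (suc k)
  unmerge = Sum.map₂ (punchIn b)

  unmerge-merged : punchIn b merged ≡ a
  unmerge-merged = punchIn-punchOut _

  module _ (Fv : Subset (suc k)) (Fe : Subset (suc m)) where

    cut : Bool
    cut = lookup Fv a ∨ lookup Fv b ∨ lookup Fe f

    Fv° : Subset k
    Fv° = removeAt Fv b [ merged ]≔ cut

    Fe° : Subset m
    Fe° = removeAt Fe f

    merged-alive : merged ∉ Fv° → a ∉ Fv × b ∉ Fv × f ∉ Fe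
    merged-alive merged∉ with ∨³≡false _ _ _ (trans (sym (lookup∘update merged (removeAt Fv b) cut))
                                                   (∉⇒lookup≡false merged∉))
    ... | α≡false , β≡false , γ≡false =
      lookup≡false⇒∉ α≡false , lookup≡false⇒∉ β≡false , lookup≡false⇒∉ γ≡false

    unmerge-alive : ∀ y → Alive Fv° y → Alive Fv (unmerge y)
    unmerge-alive (inj₁ _) _ = tt
    unmerge-alive (inj₂ w) w∉ with w ≟ merged
    ... | yes refl = subst (_∉ Fv) (sym unmerge-merged) (proj₁ (merged-alive w∉))
    ... | no  w≢merged = lookup≡false⇒∉ (begin
      lookup Fv (punchIn b w)     ≡⟨ lookup-removeAt Fv b w ⟨
      lookup (removeAt Fv b) w    ≡⟨ lookup∘update′ w≢merged (removeAt Fv b) cut ⟨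
      lookup Fv° w                ≡⟨ ∉⇒lookup≡false w∉ ⟩
      false                       ∎)
      where open ≡-Reasoning

    -- The only non-trivial fibre of merge is {a, b}, connected by f.
    fibre : ∀ x₀ → Alive Fv° (merge x₀)
          → Alive Fv x₀ × Reach G Fv Fe (unmerge (merge x₀)) x₀ × Reach G Fv Fe x₀ (unmerge (merge x₀))
    fibre (inj₁ _) _ = tt , stop , stop
    fibre (inj₂ c) al with b ≟ c
    ... | yes refl = b∉ , subst (λ x → Reach G Fv Fe x (inj₂ b)) a≡ (step f f∉ J b∉ stop)
                        , subst (Reach G Fv Fe (inj₂ b)) a≡ (step f f∉ (Sum.swap J) a∉ stop)
      where
      a∉b∉f∉ : a ∉ Fv × b ∉ Fv × f ∉ Fe
      a∉b∉f∉ = merged-alive al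
      a∉ = proj₁ a∉b∉f∉
      b∉ = proj₁ (proj₂ a∉b∉f∉)
      f∉ = proj₂ (proj₂ a∉b∉f∉)
      a≡ : inj₂ a ≡ inj₂ (punchIn b merged)
      a≡ = cong inj₂ (sym unmerge-merged)
    ... | no b≢c rewrite punchIn-punchOut b≢c =
      subst (_∉ Fv) (punchIn-punchOut b≢c) (unmerge-alive (inj₂ _) al) , stop , stop

    lift-edge : ∀ {x₀ y₀} g → g ∉ Fe° → Joins G (punchIn f g) x₀ y₀
              → Alive Fv° (merge x₀) → Alive Fv° (merge y₀)
              → Reach G Fv Fe (unmerge (merge x₀)) (unmerge (merge y₀))
    lift-edge g g∉ Jg alx aly with fibre _ alx | fibre _ aly
    ... | _ , to-x₀ , _ | y₀-alive , _ , from-y₀ =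
      Reach-trans to-x₀ (step (punchIn f g) (g∉ ∘ ∈-removeAt Fe f g) Jg y₀-alive from-y₀)

    lift : ∀ {x z} → Reach (contract G f a b a≢b) Fv° Fe° x z → Alive Fv° x
         → Reach G Fv Fe (unmerge x) (unmerge z)
    lift stop _ = stop
    lift (step g g∉ (inj₁ refl) aly p) alx = Reach-trans (lift-edge g g∉ (inj₁ refl) alx aly) (lift p aly)
    lift (step g g∉ (inj₂ refl) aly p) alx = Reach-trans (lift-edge g g∉ (inj₂ refl) alx aly) (lift p aly)

    size : ∣ Fv° ∣ + ∣ Fe° ∣ ≤ ∣ Fv ∣ + ∣ Fe ∣
    size = +-cancelˡ-≤ iα _ _ (begin
      iα + (∣ Fv° ∣ + ∣ Fe° ∣)            ≡⟨ +-assoc iα _ _ ⟨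
      iα + ∣ Fv° ∣ + ∣ Fe° ∣              ≡⟨ cong (_+ ∣ Fe° ∣) Fv°-size ⟩
      indicator cut + ∣ R ∣ + ∣ Fe° ∣     ≤⟨ +-monoˡ-≤ ∣ Fe° ∣ (+-monoˡ-≤ ∣ R ∣ (indicator-∨ α β γ)) ⟩
      iα + iβ + iγ + ∣ R ∣ + ∣ Fe° ∣      ≡⟨ rearrange iα iβ iγ ∣ R ∣ ∣ Fe° ∣ ⟩
      iα + ((iβ + ∣ R ∣) + (iγ + ∣ Fe° ∣)) ≡⟨ cong₂ (λ x y → iα + (x + y)) (∣removeAt∣ Fv b) (∣removeAt∣ Fe f) ⟩
      iα + (∣ Fv ∣ + ∣ Fe ∣)              ∎)
      where
      open ≤-Reasoning
      open +-*-Solver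
      α = lookup Fv a
      β = lookup Fv b
      γ = lookup Fe f
      iα = indicator α
      iβ = indicator β
      iγ = indicator γ
      R = removeAt Fv b
      Fv°-size : iα + ∣ Fv° ∣ ≡ indicator cut + ∣ R ∣
      Fv°-size = subst (λ x → indicator x + ∣ Fv° ∣ ≡ indicator cut + ∣ R ∣)
                       (trans (lookup-removeAt Fv b merged) (cong (lookup Fv) unmerge-merged))
                       (∣update∣ R merged cut)
      rearrange : ∀ a b c r e → a + b + c + r + e ≡ a + ((b + r) + (c + e))
      rearrange = solve 5 (λ a b c r e → a :+ b :+ c :+ r :+ e := a :+ ((b :+ r) :+ (c :+ e))) refl

  contract-separatorTransfer : SeparatorTransfer G (contract G f a b a≢b)
  contract-separatorTransfer u v Fv Fe sep = Fv° Fv Fe , Fe° Fv Fe , (λ p → sep (lift Fv Fe p tt)) , size Fv Fe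

-- Reductions commute with deleting an edge

open Contraction using (contract-separatorTransfer)

punchIn-comm : ∀ {m} (e : Fin (suc (suc m))) (x : Fin (suc m)) (j : Fin m)
             → punchIn e (punchIn x j) ≡ punchIn (punchIn e x) (punchIn (punchOut (punchInᵢ≢i e x)) j)
punchIn-comm zero    x       j       = refl
punchIn-comm (suc e) zero    j       = refl
punchIn-comm {suc m} (suc e) (suc x) zero    = refl
punchIn-comm {suc m} (suc e) (suc x) (suc j) = cong suc (punchIn-comm e x j)

delete-delete-separatorTransfer : ∀ {t k m} (G : Graph t k (suc (suc m))) e x
  → SeparatorTransfer (delete G (punchIn e x)) (delete (delete G e) x)
delete-delete-separatorTransfer G e x = SeparatorTransfer-trans
  (delete-separatorTransfer (delete G (punchIn e x)) (punchOut (punchInᵢ≢i e x)))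
  (SeparatorTransfer-resp-ends (λ j → cong (ends G) (sym (punchIn-comm e x j))))

delete-contract-separatorTransfer : ∀ {t k m} (G : Graph t (suc k) (suc (suc m))) e x
  (p q : Fin (suc k)) (p≢q : p ≢ q) → Joins G e (inj₂ p) (inj₂ q)
  → SeparatorTransfer (delete G (punchIn e x)) (delete (contract G e p q p≢q) x)
delete-contract-separatorTransfer {m = m} G e x p q p≢q J = SeparatorTransfer-trans
  (contract-separatorTransfer (delete G (punchIn e x)) e° p q p≢q
    (subst (λ d → Joins G d (inj₂ p) (inj₂ q)) (sym (punchIn-punchOut e≢)) J))
  (SeparatorTransfer-resp-ends (λ j → cong (Prod.map (mergeV p q p≢q) (mergeV p q p≢q) ∘ ends G)
                                            (sym (punchIn-comm e x j))))
  where
  e≢ : punchIn e x ≢ e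
  e≢ = punchInᵢ≢i e x
  e° : Fin (suc m)
  e° = punchOut e≢

Reduces-delete-separatorTransfer : ∀ {t k m k′ m′} {G : Graph t k (suc m)} {G′ : Graph t k′ (suc m′)} {ρ}
  → Reduces G G′ ρ → ∀ e′ → SeparatorTransfer (delete G (ρ e′)) (delete G′ e′)
Reduces-delete-separatorTransfer done e′ = SeparatorTransfer-refl
Reduces-delete-separatorTransfer {m = zero} (del {ρ = ρ} _ _ _ _ _ _) e′ with () ← ρ e′
Reduces-delete-separatorTransfer {m = suc _} {G = G} (del {ρ = ρ} e _ _ _ _ G°↠G′) e′ =
  SeparatorTransfer-trans (delete-delete-separatorTransfer G e (ρ e′))
                          (Reduces-delete-separatorTransfer G°↠G′ e′)
Reduces-delete-separatorTransfer {m = zero} (con {ρ = ρ} _ _ _ _ _ _ _) e′ with () ← ρ e′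
Reduces-delete-separatorTransfer {m = suc _} {G = G} (con {ρ = ρ} e p q p≢q J _ G°↠G′) e′ =
  SeparatorTransfer-trans (delete-contract-separatorTransfer G e (ρ e′) p q p≢q J)
                          (Reduces-delete-separatorTransfer G°↠G′ e′)

Reduces-preservesEC : ∀ {t k m k′ m′} {G : Graph t k m} {G′ : Graph t k′ m′} {ρ}
                    → Reduces G G′ ρ → PreservesEC G G′
Reduces-preservesEC done                          u v u≢v c = ⇔-id _
Reduces-preservesEC (del _ _ _ _ preserves G°↠G′)   u v u≢v c =
  preserves u v u≢v c ⇔-∘ Reduces-preservesEC G°↠G′ u v u≢v c
Reduces-preservesEC (con _ _ _ _ _ preserves G°↠G′) u v u≢v c =
  preserves u v u≢v c ⇔-∘ Reduces-preservesEC G°↠G′ u v u≢v c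

mainTheorem1 : ∀ {t k m k' m'} (G : Graph t k (suc m)) (G' : Graph t k' (suc m'))
                 (ρ : Fin (suc m') → Fin (suc m)) → Reduces G G' ρ
               → (e' : Fin (suc m')) (p' q' : Fin k') → Joins G' e' (inj₂ p') (inj₂ q')
               → PreservesEC G' (delete G' e')
               → PreservesEC G (delete G (ρ e'))
mainTheorem1 G G' ρ G↠G' e' _ _ _ preserves u v u≢v =
  ElemConn-⇔ κ[G-pq] κ[G]
  where
  d : ℕ
  d = proj₁ (ElemConn-exists G u v u≢v)
  κ[G] : ElemConn G u v d
  κ[G] = proj₂ (ElemConn-exists G u v u≢v)
  κ[G'] : ElemConn G' u v d
  κ[G'] = Equivalence.from (Reduces-preservesEC G↠G' u v u≢v d) κ[G]
  κ[G'-p'q'] : ElemConn (delete G' e') u v d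
  κ[G'-p'q'] = Equivalence.from (preserves u v u≢v d) κ[G']
  κ[G-pq] : ElemConn (delete G (ρ e')) u v d
  κ[G-pq] = ElemConn-squeeze (delete-separatorTransfer G (ρ e'))
                             (Reduces-delete-separatorTransfer G↠G' e') κ[G] κ[G'-p'q']
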